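{- Let $n$ be a positive integer and let $A\subseteq[2]^n$ have equal-slices density $\delta$. Then the set $L(A)=\{y\in[3]^n: y^{3\rightarrow1}\in A \text{ and } y^{3\rightarrow 2}\in A\}$ of (possibly degenerate) combinatorial lines in $A$ has equal-slices measure (in $[3]^n$) at least $\delta^2(n+1)/(n+2)$.
   Context: $[k]=\{1,\dots,k\}$. The equal-slices measure on $[k]^n$: choose, uniformly among all possibilities, a $k$-tuple $(a_1,\dots,a_k)$ of non-negative integers with sum $n$, then choose $x\in[k]^n$ uniformly among the sequences with $|\{i:x_i=j\}|=a_j$ for all $j$. For $y\in[k+1]^n$ and $j\in[k]$, $y^{k+1\rightarrow j}$ denotes the sequence obtained by replacing every coordinate equal to $k+1$ by $j$. A point $y\in[k+1]^n$ is identified with the (possibly degenerate, i.e. with empty wildcard set) combinatorial line $\{y^{k+1\rightarrow j}:j\in[k]\}$ of $[k]^n$, whose wildcard set is $\{i:y_i=k+1\}$; the equal-slices density of a set of lines is the equal-slices measure of the corresponding set of points of $[k+1]^n$. -}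

module Defs where

open import Data.Nat as ℕ using (ℕ; zero; suc; _∸_)
open import Data.Fin as Fin using (Fin; zero; suc; toℕ; lower₁)
open import Data.Vec as Vec using (Vec; []; _∷_)
open import Data.Vec.Properties using (≡-dec)
open import Data.List as List using (List; []; _∷_; [_]; concatMap; filter; length; upTo; allFin)
open import Data.Bool using (Bool; true; false; T?; _∧_)
open import Data.Integer using (+_)
open import Data.Rational as ℚ using (ℚ; 0ℚ)
open import Relation.Nullary using (yes; no)
open import Relation.Nullary.Decidable using (⌊_⌋)

-- a / b as a rational; only ever used with b ≥ 1 (b = 0 gives 0 by convention)
frac : ℕ → ℕ → ℚ
frac a zero    = 0ℚ
frac a (suc d) = (+ a) ℚ./ suc d

allVecs : (k n : ℕ) → List (Vec (Fin k) n)
allVecs k zero    = [ [] ]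
allVecs k (suc n) = concatMap (λ i → List.map (i ∷_) (allVecs k n)) (allFin k)

tuples : (k n : ℕ) → List (Vec ℕ k)
tuples zero zero    = [ [] ]
tuples zero (suc n) = []
tuples (suc k) n    = concatMap (λ a → List.map (a ∷_) (tuples k (n ∸ a))) (upTo (suc n))

count : ∀ {k n} → Fin k → Vec (Fin k) n → ℕ
count j []      = 0
count j (c ∷ x) with j Fin.≟ c
... | yes _ = suc (count j x)
... | no  _ = count j x

slice : ∀ {k n} → Vec (Fin k) n → Vec ℕ k
slice x = Vec.tabulate (λ j → count j x)

sameSlice : ∀ {k n} → Vec (Fin k) n → Vec (Fin k) n → Bool
sameSlice x y = ⌊ ≡-dec ℕ._≟_ (slice x) (slice y) ⌋

sliceSize : ∀ {k n} → Vec (Fin k) n → ℕ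
sliceSize {k} {n} x = length (filter (λ y → T? (sameSlice x y)) (allVecs k n))

esWeight : (k n : ℕ) → Vec (Fin k) n → ℚ
esWeight k n x = frac 1 (length (tuples k n) ℕ.* sliceSize x)

sumℚ : List ℚ → ℚ
sumℚ = List.foldr ℚ._+_ 0ℚ

esMeasure : (k n : ℕ) → (Vec (Fin k) n → Bool) → ℚ
esMeasure k n S = sumℚ (List.map (esWeight k n) (filter (λ x → T? (S x)) (allVecs k n)))

-- replace the value k+1 (= Fin.fromℕ k) by j, keep other values
replaceTop : ∀ {k} → Fin k → Fin (suc k) → Fin k
replaceTop {k} j c with k ℕ.≟ toℕ c
... | yes _ = j
... | no ne = lower₁ c ne

subst→ : ∀ {k n} → Vec (Fin (suc k)) n → Fin k → Vec (Fin k) n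
subst→ y j = Vec.map (replaceTop j) y

lines : ∀ {n} → (Vec (Fin 2) n → Bool) → Vec (Fin 3) n → Bool
lines A y = A (subst→ y zero) ∧ A (subst→ y (suc zero))

-- Average over the n! maximal chains of [2]ⁿ.  A point with a coordinates equal to 1F lies on
-- a! (n − a)! of them, always as the a-th point, so a uniform chain together with a uniform index
-- a ≤ n samples [2]ⁿ by equal slices.  Likewise a uniform chain together with a uniform pair
-- i ≤ j samples [3]ⁿ by equal slices, through the line joining the i-th and j-th chain points.
-- If Y is the number of points of A on the chain, then δ = E[Y] / (n + 1), while the lines have
-- measure E[#{i ≤ j : both points in A}] / binom(n + 2, 2) ≥ E[Y²] / ((n + 1)(n + 2)), and
-- Cauchy–Schwarz E[Y²] ≥ E[Y]² finishes the proof.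
module Submission where

open import Data.Nat
open import Data.Nat.Properties
open import Data.Nat.Tactic.RingSolver using (solve-∀)
open import Algebra.Properties.CommutativeSemigroup +-commutativeSemigroup using (interchange; x∙yz≈y∙xz)
open import Data.Bool using (Bool; true; false; if_then_else_; T; T?; _∧_)
open import Data.Bool.Properties using (if-float; if-cong-then)
open import Data.Integer as ℤ using (+≤+)
import Data.Integer.Properties as ℤ
open import Data.Rational.Unnormalised as ℚᵘ using (ℚᵘ; mkℚᵘ; *≡*; *≤*)
import Data.Rational.Unnormalised.Properties as ℚᵘ
import Data.Rational as ℚ
import Data.Rational.Properties as ℚ
open import Data.Fin using (Fin)
open import Data.Fin.Patterns using (0F; 1F; 2F)
open import Data.Vec using (Vec; []; _∷_; lookup)
open import Data.Vec.Properties using (≡-dec)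
open import Data.List using (List; []; _∷_; _++_; concatMap; map; filter; length; applyUpTo; upTo; allFin)
import Data.List.Properties as List
open import Data.Product using (_×_; _,_; proj₁; proj₂)
open import Data.Unit using (⊤; tt)
open import Function using (_∘_; id)
open import Relation.Binary.PropositionalEquality
open import Relation.Nullary.Reflects using (ofʸ; ofⁿ)
open import Relation.Nullary.Decidable using (dec-true; toWitness; isYes≗does)
open import Relation.Nullary.Negation using (contradiction)

open import Defs

private variable
  A B : Set
  n : ℕ

𝟙 : Bool → ℕ
𝟙 true  = 1
𝟙 false = 0

𝟙-≡ᵇ-refl : ∀ m → 𝟙 (m ≡ᵇ m) ≡ 1
𝟙-≡ᵇ-refl zero    = refl
𝟙-≡ᵇ-refl (suc m) = 𝟙-≡ᵇ-refl m

𝟙-∧ : ∀ a b → 𝟙 (a ∧ b) ≡ 𝟙 a * 𝟙 b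
𝟙-∧ true  b = sym (+-identityʳ (𝟙 b))
𝟙-∧ false b = refl

∑ : List A → (A → ℕ) → ℕ
∑ []       f = 0
∑ (x ∷ xs) f = f x + ∑ xs f

syntax ∑ xs (λ x → e) = ∑[ x ∈ xs ] e

∑< : ℕ → (ℕ → ℕ) → ℕ
∑< zero    f = 0
∑< (suc m) f = f 0 + ∑< m (f ∘ suc)

syntax ∑< m (λ a → e) = ∑[ a < m ] e

∑≤≤ : ℕ → (ℕ → ℕ → ℕ) → ℕ
∑≤≤ m F = ∑[ j < suc m ] ∑[ i < suc j ] F i j

syntax ∑≤≤ m (λ i j → e) = ∑[ i ≤ j ≤ m ] e

∑-cong : ∀ (xs : List A) {f g : A → ℕ} → (∀ x → f x ≡ g x) → ∑ xs f ≡ ∑ xs g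
∑-cong []       eq = refl
∑-cong (x ∷ xs) eq = cong₂ _+_ (eq x) (∑-cong xs eq)

∑-mono-≤ : ∀ (xs : List A) {f g : A → ℕ} → (∀ x → f x ≤ g x) → ∑ xs f ≤ ∑ xs g
∑-mono-≤ []       h = z≤n
∑-mono-≤ (x ∷ xs) h = +-mono-≤ (h x) (∑-mono-≤ xs h)

∑-+ : ∀ (xs : List A) (f g : A → ℕ) → ∑[ x ∈ xs ] (f x + g x) ≡ ∑ xs f + ∑ xs g
∑-+ []       f g = refl
∑-+ (x ∷ xs) f g = trans (cong (f x + g x +_) (∑-+ xs f g)) (interchange (f x) (g x) _ _)

∑-*ˡ : ∀ (xs : List A) c (f : A → ℕ) → ∑[ x ∈ xs ] (c * f x) ≡ c * ∑ xs f
∑-*ˡ []       c f = sym (*-zeroʳ c)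
∑-*ˡ (x ∷ xs) c f = trans (cong (c * f x +_) (∑-*ˡ xs c f)) (sym (*-distribˡ-+ c (f x) _))

∑-*ʳ : ∀ (xs : List A) c (f : A → ℕ) → ∑[ x ∈ xs ] (f x * c) ≡ ∑ xs f * c
∑-*ʳ xs c f = trans (∑-cong xs (λ x → *-comm (f x) c)) (trans (∑-*ˡ xs c f) (*-comm c _))

∑-++ : ∀ (xs ys : List A) (f : A → ℕ) → ∑ (xs ++ ys) f ≡ ∑ xs f + ∑ ys f
∑-++ []       ys f = refl
∑-++ (x ∷ xs) ys f = trans (cong (f x +_) (∑-++ xs ys f)) (sym (+-assoc (f x) _ _))

∑-map : ∀ (h : A → B) (xs : List A) (f : B → ℕ) → ∑ (map h xs) f ≡ ∑ xs (f ∘ h)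
∑-map h []       f = refl
∑-map h (x ∷ xs) f = cong (f (h x) +_) (∑-map h xs f)

∑-concatMap : ∀ (g : A → List B) (xs : List A) (f : B → ℕ) →
  ∑ (concatMap g xs) f ≡ ∑[ x ∈ xs ] ∑ (g x) f
∑-concatMap g []       f = refl
∑-concatMap g (x ∷ xs) f =
  trans (∑-++ (g x) (concatMap g xs) f) (cong (∑ (g x) f +_) (∑-concatMap g xs f))

length-concatMap : ∀ (g : A → List B) (xs : List A) →
  length (concatMap g xs) ≡ ∑[ x ∈ xs ] length (g x)
length-concatMap g []       = refl
length-concatMap g (x ∷ xs) =
  trans (List.length-++ (g x)) (cong (length (g x) +_) (length-concatMap g xs))

∑-1≡length : ∀ (xs : List A) → ∑[ _ ∈ xs ] 1 ≡ length xs
∑-1≡length []       = refl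
∑-1≡length (x ∷ xs) = cong suc (∑-1≡length xs)

length-filter : ∀ (b : A → Bool) (xs : List A) → length (filter (λ y → T? (b y)) xs) ≡ ∑[ y ∈ xs ] 𝟙 (b y)
length-filter b []       = refl
length-filter b (x ∷ xs) with b x
... | true  = cong suc (length-filter b xs)
... | false = length-filter b xs

∑-upTo : ∀ m (f : ℕ → ℕ) → ∑ (upTo m) f ≡ ∑< m f
∑-upTo = go id
  where
  go : ∀ (g : ℕ → ℕ) m (f : ℕ → ℕ) → ∑ (applyUpTo g m) f ≡ ∑< m (f ∘ g)
  go g zero    f = refl
  go g (suc m) f = cong (f (g 0) +_) (go (g ∘ suc) m f)

∑<-cong : ∀ m {f g : ℕ → ℕ} → (∀ a → a < m → f a ≡ g a) → ∑< m f ≡ ∑< m g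
∑<-cong zero    eq = refl
∑<-cong (suc m) eq = cong₂ _+_ (eq 0 z<s) (∑<-cong m (λ a a<m → eq (suc a) (s<s a<m)))

∑<-+ : ∀ m (f g : ℕ → ℕ) → ∑[ a < m ] (f a + g a) ≡ ∑< m f + ∑< m g
∑<-+ zero    f g = refl
∑<-+ (suc m) f g = trans (cong (f 0 + g 0 +_) (∑<-+ m (f ∘ suc) (g ∘ suc))) (interchange (f 0) (g 0) _ _)

∑<-*ˡ : ∀ m c (f : ℕ → ℕ) → ∑[ a < m ] (c * f a) ≡ c * ∑< m f
∑<-*ˡ zero    c f = sym (*-zeroʳ c)
∑<-*ˡ (suc m) c f = trans (cong (c * f 0 +_) (∑<-*ˡ m c (f ∘ suc))) (sym (*-distribˡ-+ c (f 0) _))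

∑<-const : ∀ m c → ∑[ _ < m ] c ≡ m * c
∑<-const zero    c = refl
∑<-const (suc m) c = cong (c +_) (∑<-const m c)

∑<-last : ∀ m (f : ℕ → ℕ) → ∑< (suc m) f ≡ ∑< m f + f m
∑<-last zero    f = +-comm (f 0) 0
∑<-last (suc m) f = trans (cong (f 0 +_) (∑<-last m (f ∘ suc))) (sym (+-assoc (f 0) _ _))

∑<-∑-comm : ∀ m (xs : List A) (F : ℕ → A → ℕ) →
  ∑[ a < m ] ∑ xs (F a) ≡ ∑[ x ∈ xs ] ∑[ a < m ] F a x
∑<-∑-comm zero    xs F = sym (∑-*ˡ xs 0 (λ _ → 0))
∑<-∑-comm (suc m) xs F =
  trans (cong (∑ xs (F 0) +_) (∑<-∑-comm m xs (F ∘ suc))) (sym (∑-+ xs (F 0) _))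

∑<-comm : ∀ m p (F : ℕ → ℕ → ℕ) → ∑[ a < m ] ∑< p (F a) ≡ ∑[ b < p ] ∑[ a < m ] F a b
∑<-comm zero    p F = sym (trans (∑<-const p 0) (*-zeroʳ p))
∑<-comm (suc m) p F =
  trans (cong (∑< p (F 0) +_) (∑<-comm m p (F ∘ suc))) (sym (∑<-+ p (F 0) _))

∑<-pick : ∀ m t (g : ℕ → ℕ) → t < m → ∑[ a < m ] (𝟙 (a ≡ᵇ t) * g a) ≡ g t
∑<-pick (suc m) zero    g _ = trans (cong (g 0 + 0 +_) (trans (∑<-const m 0) (*-zeroʳ m)))
                                    (trans (+-identityʳ _) (+-identityʳ (g 0)))
∑<-pick (suc m) (suc t) g (s<s t<m) = ∑<-pick m t (g ∘ suc) t<m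

∑≤≤-cong : ∀ m {F G : ℕ → ℕ → ℕ} → (∀ i j → i ≤ j → j ≤ m → F i j ≡ G i j) →
  ∑≤≤ m F ≡ ∑≤≤ m G
∑≤≤-cong m eq = ∑<-cong (suc m) (λ j j<1+m → ∑<-cong (suc j) (λ i i<1+j →
  eq i j (≤-pred i<1+j) (≤-pred j<1+m)))

∑≤≤-+ : ∀ m (F G : ℕ → ℕ → ℕ) → ∑[ i ≤ j ≤ m ] (F i j + G i j) ≡ ∑≤≤ m F + ∑≤≤ m G
∑≤≤-+ m F G = trans (∑<-cong (suc m) (λ j _ → ∑<-+ (suc j) (λ i → F i j) (λ i → G i j)))
  (∑<-+ (suc m) (λ j → ∑[ i < suc j ] F i j) (λ j → ∑[ i < suc j ] G i j))

∑≤≤-pick : ∀ m s t (g : ℕ → ℕ → ℕ) → s ≤ t → t ≤ m →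
  ∑[ i ≤ j ≤ m ] (𝟙 (j ≡ᵇ t) * (𝟙 (i ≡ᵇ s) * g i j)) ≡ g s t
∑≤≤-pick m s t g s≤t t≤m =
  trans (∑<-cong (suc m) (λ j _ → ∑<-*ˡ (suc j) (𝟙 (j ≡ᵇ t)) (λ i → 𝟙 (i ≡ᵇ s) * g i j)))
    (trans (∑<-pick (suc m) t (λ j → ∑[ i < suc j ] (𝟙 (i ≡ᵇ s) * g i j)) (s≤s t≤m))
      (∑<-pick (suc t) s (λ i → g i t) (s≤s s≤t)))

∑<-if-<ᵇ : ∀ m a (x y : ℕ) → a ≤ m → ∑[ k < m ] (if k <ᵇ a then y else x) ≡ (m ∸ a) * x + a * y
∑<-if-<ᵇ zero    zero    x y _ = refl
∑<-if-<ᵇ (suc m) zero    x y _ = trans (cong (x +_) (∑<-if-<ᵇ m zero x y z≤n)) (sym (+-assoc x _ _))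
∑<-if-<ᵇ (suc m) (suc a) x y (s≤s a≤m) =
  trans (cong (y +_) (∑<-if-<ᵇ m a x y a≤m)) (x∙yz≈y∙xz y ((m ∸ a) * x) (a * y))

∑<-if-<ᵇ-if-<ᵇ : ∀ m i j (x w q : ℕ) → i ≤ j → j ≤ m →
  ∑[ k < m ] (if k <ᵇ j then (if k <ᵇ i then q else w) else x) ≡ (m ∸ j) * x + ((j ∸ i) * w + i * q)
∑<-if-<ᵇ-if-<ᵇ zero    zero    zero    x w q _ _ = refl
∑<-if-<ᵇ-if-<ᵇ (suc m) zero    zero    x w q _ _ =
  trans (cong (x +_) (∑<-if-<ᵇ-if-<ᵇ m 0 0 x w q z≤n z≤n)) (sym (+-assoc x _ _))
∑<-if-<ᵇ-if-<ᵇ (suc m) zero    (suc j) x w q _ (s≤s j≤m) =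
  trans (cong (w +_) (∑<-if-<ᵇ-if-<ᵇ m 0 j x w q z≤n j≤m))
    (trans (x∙yz≈y∙xz w ((m ∸ j) * x) (j * w + 0)) (cong ((m ∸ j) * x +_) (sym (+-assoc w (j * w) 0))))
∑<-if-<ᵇ-if-<ᵇ (suc m) (suc i) (suc j) x w q (s≤s i≤j) (s≤s j≤m) =
  trans (cong (q +_) (∑<-if-<ᵇ-if-<ᵇ m i j x w q i≤j j≤m))
    (trans (x∙yz≈y∙xz q ((m ∸ j) * x) ((j ∸ i) * w + i * q))
      (cong ((m ∸ j) * x +_) (x∙yz≈y∙xz q ((j ∸ i) * w) (i * q))))

∑<-∑<-split : ∀ m (P Q : ℕ → ℕ) →
  ∑[ k < suc m ] ∑[ a < suc (suc m) ] (if k <ᵇ a then Q (pred a) else P a) ≡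
  ∑[ a < suc m ] ((suc m ∸ a) * P a) + ∑[ a < suc m ] (suc a * Q a)
∑<-∑<-split m P Q = begin
  ∑[ k < suc m ] ∑[ a < suc (suc m) ] (if k <ᵇ a then Q (pred a) else P a)
    ≡⟨ ∑<-comm (suc m) (suc (suc m)) (λ k a → if k <ᵇ a then Q (pred a) else P a) ⟩
  ∑[ a < suc (suc m) ] ∑[ k < suc m ] (if k <ᵇ a then Q (pred a) else P a)
    ≡⟨ ∑<-cong (suc (suc m)) (λ a a<2+m → ∑<-if-<ᵇ (suc m) a (P a) (Q (pred a)) (≤-pred a<2+m)) ⟩
  ∑[ a < suc (suc m) ] ((suc m ∸ a) * P a + a * Q (pred a))
    ≡⟨ ∑<-+ (suc (suc m)) (λ a → (suc m ∸ a) * P a) (λ a → a * Q (pred a)) ⟩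
  ∑[ a < suc (suc m) ] ((suc m ∸ a) * P a) + ∑[ a < suc m ] (suc a * Q a)
    ≡⟨ cong (_+ ∑[ a < suc m ] (suc a * Q a)) last-term-vanishes ⟩
  ∑[ a < suc m ] ((suc m ∸ a) * P a) + ∑[ a < suc m ] (suc a * Q a) ∎
  where
  open ≡-Reasoning
  last-term-vanishes : ∑[ a < suc (suc m) ] ((suc m ∸ a) * P a) ≡ ∑[ a < suc m ] ((suc m ∸ a) * P a)
  last-term-vanishes = begin
    ∑[ a < suc (suc m) ] ((suc m ∸ a) * P a)
      ≡⟨ ∑<-last (suc m) (λ a → (suc m ∸ a) * P a) ⟩
    ∑[ a < suc m ] ((suc m ∸ a) * P a) + (m ∸ m) * P (suc m)
      ≡⟨ cong (λ z → ∑[ a < suc m ] ((suc m ∸ a) * P a) + z * P (suc m)) (n∸n≡0 m) ⟩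
    ∑[ a < suc m ] ((suc m ∸ a) * P a) + 0
      ≡⟨ +-identityʳ _ ⟩
    ∑[ a < suc m ] ((suc m ∸ a) * P a) ∎

∑<-∑≤≤-split : ∀ m (P W Q : ℕ → ℕ → ℕ) →
  ∑[ k < suc m ] ∑[ i ≤ j ≤ suc m ]
     (if k <ᵇ j then (if k <ᵇ i then Q (pred i) (pred j) else W i (pred j)) else P i j) ≡
  ∑[ i ≤ j ≤ m ] ((suc m ∸ j) * P i j) +
  (∑[ i ≤ j ≤ m ] ((suc j ∸ i) * W i j) + ∑[ i ≤ j ≤ m ] (suc i * Q i j))
∑<-∑≤≤-split m P W Q = begin
  ∑[ k < suc m ] ∑[ j < suc (suc m) ] ∑[ i < suc j ] G k i j
    ≡⟨ ∑<-comm (suc m) (suc (suc m)) (λ k j → ∑[ i < suc j ] G k i j) ⟩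
  ∑[ j < suc (suc m) ] ∑[ k < suc m ] ∑[ i < suc j ] G k i j
    ≡⟨ ∑<-cong (suc (suc m)) (λ j _ → ∑<-comm (suc m) (suc j) (λ k i → G k i j)) ⟩
  ∑[ i ≤ j ≤ suc m ] ∑[ k < suc m ] G k i j
    ≡⟨ ∑≤≤-cong (suc m) (λ i j i≤j j≤1+m →
         ∑<-if-<ᵇ-if-<ᵇ (suc m) i j (P i j) (W i (pred j)) (Q (pred i) (pred j)) i≤j j≤1+m) ⟩
  ∑[ i ≤ j ≤ suc m ] ((suc m ∸ j) * P i j + ((j ∸ i) * W i (pred j) + i * Q (pred i) (pred j)))
    ≡⟨ ∑≤≤-+ (suc m) (λ i j → (suc m ∸ j) * P i j)
               (λ i j → (j ∸ i) * W i (pred j) + i * Q (pred i) (pred j)) ⟩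
  ∑[ i ≤ j ≤ suc m ] ((suc m ∸ j) * P i j) +
  ∑[ i ≤ j ≤ suc m ] ((j ∸ i) * W i (pred j) + i * Q (pred i) (pred j))
    ≡⟨ cong₂ _+_ last-row-vanishes
         (trans (∑≤≤-+ (suc m) (λ i j → (j ∸ i) * W i (pred j)) (λ i j → i * Q (pred i) (pred j)))
                (cong (_+ ∑[ i ≤ j ≤ m ] (suc i * Q i j)) diagonal-vanishes)) ⟩
  ∑[ i ≤ j ≤ m ] ((suc m ∸ j) * P i j) +
  (∑[ i ≤ j ≤ m ] ((suc j ∸ i) * W i j) + ∑[ i ≤ j ≤ m ] (suc i * Q i j)) ∎
  where
  open ≡-Reasoning
  G : ℕ → ℕ → ℕ → ℕ
  G k i j = if k <ᵇ j then (if k <ᵇ i then Q (pred i) (pred j) else W i (pred j)) else P i j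
  last-row-vanishes : ∑[ i ≤ j ≤ suc m ] ((suc m ∸ j) * P i j) ≡ ∑[ i ≤ j ≤ m ] ((suc m ∸ j) * P i j)
  last-row-vanishes rewrite ∑<-last (suc m) (λ j → ∑[ i < suc j ] ((suc m ∸ j) * P i j)) | n∸n≡0 m =
    trans (cong (∑[ i ≤ j ≤ m ] ((suc m ∸ j) * P i j) +_) (trans (∑<-const (suc (suc m)) 0) (*-zeroʳ (suc (suc m)))))
          (+-identityʳ _)
  diagonal-vanishes : ∑[ i ≤ j ≤ suc m ] ((j ∸ i) * W i (pred j)) ≡ ∑[ i ≤ j ≤ m ] ((suc j ∸ i) * W i j)
  diagonal-vanishes = ∑<-cong (suc m) (λ j _ →
    trans (∑<-last (suc j) (λ i → (suc j ∸ i) * W i j))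
          (trans (cong (λ z → ∑[ i < suc j ] ((suc j ∸ i) * W i j) + z * W (suc j) j) (n∸n≡0 j))
                 (+-identityʳ _)))

am-gm : ∀ a b → 2 * (a * b) ≤ a * a + b * b
am-gm zero    b       = z≤n
am-gm (suc a) zero    = subst (λ z → 2 * z ≤ suc a * suc a + 0) (sym (*-zeroʳ a)) z≤n
am-gm (suc a) (suc b) = subst₂ _≤_ (sym (lhs a b)) (sym (rhs a b)) (+-monoˡ-≤ _ (am-gm a b))
  where
  lhs : ∀ a b → 2 * (suc a * suc b) ≡ 2 * (a * b) + (2 * a + 2 * b + 2)
  lhs = solve-∀
  rhs : ∀ a b → suc a * suc a + suc b * suc b ≡ (a * a + b * b) + (2 * a + 2 * b + 2)
  rhs = solve-∀

square-≤-2*∑≤≤ : ∀ m (f : ℕ → ℕ) → ∑< (suc m) f * ∑< (suc m) f ≤ 2 * ∑[ i ≤ j ≤ m ] (f i * f j)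
square-≤-2*∑≤≤ zero    f = subst₂ _≤_ (sym (lhs (f 0))) (sym (rhs (f 0))) (m≤m+n _ _)
  where
  lhs : ∀ a → (a + 0) * (a + 0) ≡ a * a
  lhs = solve-∀
  rhs : ∀ a → 2 * (a * a + 0 + 0) ≡ a * a + a * a
  rhs = solve-∀
square-≤-2*∑≤≤ (suc m) f = subst₂ _≤_ (cong (λ z → z * z) (sym ∑f≡Y+x)) (cong (2 *_) (sym ∑≤≤-last))
  (begin
    (Y + x) * (Y + x)               ≡⟨ expand Y x ⟩
    Y * Y + (2 * (Y * x) + x * x)   ≤⟨ +-mono-≤ (square-≤-2*∑≤≤ m f) (m≤m+n _ (x * x)) ⟩
    2 * P + (2 * (Y * x) + x * x + x * x) ≡⟨ collect Y x P ⟩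
    2 * (P + (Y * x + x * x))       ∎)
  where
  open ≤-Reasoning
  Y = ∑< (suc m) f
  x = f (suc m)
  P = ∑[ i ≤ j ≤ m ] (f i * f j)
  ∑f≡Y+x : ∑< (suc (suc m)) f ≡ Y + x
  ∑f≡Y+x = ∑<-last (suc m) f
  ∑≤≤-last : ∑[ i ≤ j ≤ suc m ] (f i * f j) ≡ P + (Y * x + x * x)
  ∑≤≤-last = trans (∑<-last (suc m) (λ j → ∑[ i < suc j ] (f i * f j)))
    (cong (P +_) (trans (∑<-last (suc m) (λ i → f i * x))
      (cong (_+ x * x) (trans (∑<-cong (suc m) (λ i _ → *-comm (f i) x))
        (trans (∑<-*ˡ (suc m) x f) (*-comm x Y))))))
  expand : ∀ Y x → (Y + x) * (Y + x) ≡ Y * Y + (2 * (Y * x) + x * x)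
  expand = solve-∀
  collect : ∀ Y x P → 2 * P + (2 * (Y * x) + x * x + x * x) ≡ 2 * (P + (Y * x + x * x))
  collect = solve-∀

cauchy-schwarz : ∀ {A : Set} (xs : List A) (g : A → ℕ) → ∑ xs g * ∑ xs g ≤ length xs * ∑[ x ∈ xs ] (g x * g x)
cauchy-schwarz []       g = z≤n
cauchy-schwarz {A} (x ∷ xs) g = subst₂ _≤_ (sym (expand (g x) (∑ xs g))) (sym (regroup (length xs) (g x) _))
  (+-monoʳ-≤ (g x * g x) (+-mono-≤ (cross-term-bound xs) (cauchy-schwarz xs g)))
  where
  expand : ∀ a S → (a + S) * (a + S) ≡ a * a + (2 * (a * S) + S * S)
  expand = solve-∀
  regroup : ∀ L a Q → suc L * (a * a + Q) ≡ a * a + ((Q + L * (a * a)) + L * Q)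
  regroup = solve-∀
  cross-term-bound : ∀ (ys : List A) → 2 * (g x * ∑ ys g) ≤ ∑[ y ∈ ys ] (g y * g y) + length ys * (g x * g x)
  cross-term-bound []       = subst (λ z → 2 * z ≤ 0) (sym (*-zeroʳ (g x))) z≤n
  cross-term-bound (y ∷ ys) = subst₂ _≤_ (sym (split (g x) (g y) (∑ ys g))) (sym (shuffle (g y) (g x) _ (length ys)))
    (+-mono-≤ (subst (_≤ g y * g y + g x * g x) (cong (2 *_) (*-comm (g y) (g x))) (am-gm (g y) (g x)))
              (cross-term-bound ys))
    where
    split : ∀ a b S → 2 * (a * (b + S)) ≡ 2 * (a * b) + 2 * (a * S)
    split = solve-∀
    shuffle : ∀ b a Q L → b * b + Q + suc L * (a * a) ≡ (b * b + a * a) + (Q + L * (a * a))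
    shuffle = solve-∀

∑-allVecs-suc : ∀ k n (g : Vec (Fin k) (suc n) → ℕ) →
  ∑ (allVecs k (suc n)) g ≡ ∑[ i ∈ allFin k ] ∑[ y ∈ allVecs k n ] g (i ∷ y)
∑-allVecs-suc k n g = trans (∑-concatMap (λ i → map (i ∷_) (allVecs k n)) (allFin k) g)
  (∑-cong (allFin k) (λ i → ∑-map (i ∷_) (allVecs k n) g))

-- A maximal chain 0ⁿ = p₀ < p₁ < ⋯ < pₙ = 1ⁿ in [2]ⁿ turns one coordinate from 0F to 1F at each
-- step.  It is encoded by a code k ∷ c with k ≤ n: the first coordinate turns at step k + 1 and
-- the other coordinates follow the chain coded by c.
chains : (n : ℕ) → List (Vec ℕ n)
chains zero    = [] ∷ []
chains (suc n) = concatMap (λ k → map (k ∷_) (chains n)) (upTo (suc n))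

chainPoint : Vec ℕ n → ℕ → Vec (Fin 2) n
chainPoint []      a = []
chainPoint (k ∷ c) a = if k <ᵇ a then 1F ∷ chainPoint c (pred a) else 0F ∷ chainPoint c a

-- For i ≤ j, the line whose wildcard (2F, the paper's k + 1 = 3) coordinates are those turned
-- between steps i and j of the chain: its two ends are chainPoint c i and chainPoint c j.
chainLine : Vec ℕ n → ℕ → ℕ → Vec (Fin 3) n
chainLine []      i j = []
chainLine (k ∷ c) i j =
  if k <ᵇ j then (if k <ᵇ i then 1F ∷ chainLine c (pred i) (pred j) else 2F ∷ chainLine c i (pred j))
  else 0F ∷ chainLine c i j

IsChainCode : Vec ℕ n → Set
IsChainCode []                = ⊤
IsChainCode {suc n} (k ∷ c) = k ≤ n × IsChainCode c

∑-chains-suc : ∀ n (g : Vec ℕ (suc n) → ℕ) →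
  ∑ (chains (suc n)) g ≡ ∑[ k < suc n ] ∑[ c ∈ chains n ] g (k ∷ c)
∑-chains-suc n g = trans (∑-concatMap (λ k → map (k ∷_) (chains n)) (upTo (suc n)) g)
  (trans (∑-cong (upTo (suc n)) (λ k → ∑-map (k ∷_) (chains n) g)) (∑-upTo (suc n) _))

∑-chains-cong : ∀ n {g h : Vec ℕ n → ℕ} → (∀ c → IsChainCode c → g c ≡ h c) →
  ∑ (chains n) g ≡ ∑ (chains n) h
∑-chains-cong zero    eq = cong (_+ 0) (eq [] tt)
∑-chains-cong (suc n) {g} {h} eq = trans (∑-chains-suc n g) (trans
  (∑<-cong (suc n) (λ k k<1+n → ∑-chains-cong n (λ c c-ok → eq (k ∷ c) (≤-pred k<1+n , c-ok))))
  (sym (∑-chains-suc n h)))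

∑-chains-1 : ∀ n → ∑[ _ ∈ chains n ] 1 ≡ n !
∑-chains-1 zero    = refl
∑-chains-1 (suc n) = trans (∑-chains-suc n (λ _ → 1))
  (trans (∑<-cong (suc n) (λ _ _ → ∑-chains-1 n)) (∑<-const (suc n) (n !)))

length-chains : ∀ n → length (chains n) ≡ n !
length-chains n = trans (sym (∑-1≡length (chains n))) (∑-chains-1 n)

chainPoint-∷ : ∀ k (c : Vec ℕ n) (H : ℕ → Vec (Fin 2) (suc n) → ℕ) a →
  H a (chainPoint (k ∷ c) a) ≡
  (if k <ᵇ a then H (suc (pred a)) (1F ∷ chainPoint c (pred a)) else H a (0F ∷ chainPoint c a))
chainPoint-∷ k c H zero    = refl
chainPoint-∷ k c H (suc a) = if-float (H (suc a)) (k <ᵇ suc a)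

chainLine-∷ : ∀ k (c : Vec ℕ n) (H : ℕ → ℕ → Vec (Fin 3) (suc n) → ℕ) i j →
  H i j (chainLine (k ∷ c) i j) ≡
  (if k <ᵇ j
   then (if k <ᵇ i then H (suc (pred i)) (suc (pred j)) (1F ∷ chainLine c (pred i) (pred j))
         else H i (suc (pred j)) (2F ∷ chainLine c i (pred j)))
   else H i j (0F ∷ chainLine c i j))
chainLine-∷ k c H i       zero    = refl
chainLine-∷ k c H zero    (suc j) = if-float (H 0 (suc j)) (k <ᵇ suc j)
chainLine-∷ k c H (suc i) (suc j) = trans (if-float (H (suc i) (suc j)) (k <ᵇ suc j))
  (if-cong-then (k <ᵇ suc j) (if-float (H (suc i) (suc j)) (k <ᵇ suc i)))

count-chainPoint : ∀ (c : Vec ℕ n) a → IsChainCode c → a ≤ n → count 1F (chainPoint c a) ≡ a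
count-chainPoint []      zero _ _ = refl
count-chainPoint (k ∷ c) a (k≤n , c-ok) a≤1+n with k <ᵇ a | <ᵇ-reflects-< k a
... | false | ofⁿ k≮a = count-chainPoint c a c-ok (≤-trans (≮⇒≥ k≮a) k≤n)
count-chainPoint (k ∷ c) (suc a) (k≤n , c-ok) (s≤s a≤n) | true | ofʸ _ =
  cong suc (count-chainPoint c a c-ok a≤n)

count-chainLine : ∀ (c : Vec ℕ n) i j → IsChainCode c → i ≤ j → j ≤ n →
  count 1F (chainLine c i j) ≡ i × count 2F (chainLine c i j) ≡ j ∸ i
count-chainLine []      zero zero _ _ _ = refl , refl
count-chainLine (k ∷ c) i j (k≤n , c-ok) i≤j j≤1+n with k <ᵇ j | <ᵇ-reflects-< k j | k <ᵇ i | <ᵇ-reflects-< k i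
... | false | ofⁿ k≮j | _ | _ = count-chainLine c i j c-ok i≤j (≤-trans (≮⇒≥ k≮j) k≤n)
count-chainLine (k ∷ c) i (suc j) (k≤n , c-ok) i≤j (s≤s j≤n) | true | ofʸ k<1+j | false | ofⁿ k≮i =
  let i≤j′ = ≤-pred (≤-trans (s≤s (≮⇒≥ k≮i)) k<1+j)
      (#1F , #2F) = count-chainLine c i j c-ok i≤j′ j≤n
  in #1F , trans (cong suc #2F) (sym (+-∸-assoc 1 i≤j′))
count-chainLine (k ∷ c) (suc i) (suc j) (k≤n , c-ok) (s≤s i≤j) (s≤s j≤n) | true | ofʸ _ | true | ofʸ _ =
  let (#1F , #2F) = count-chainLine c i j c-ok i≤j j≤n in cong suc #1F , #2F

chainLine→0F : ∀ (c : Vec ℕ n) i j → i ≤ j → subst→ (chainLine c i j) 0F ≡ chainPoint c i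
chainLine→0F []      i j _ = refl
chainLine→0F (k ∷ c) i j i≤j with k <ᵇ j | <ᵇ-reflects-< k j | k <ᵇ i | <ᵇ-reflects-< k i
... | false | ofⁿ _   | false | ofⁿ _   = cong (0F ∷_) (chainLine→0F c i j i≤j)
... | false | ofⁿ k≮j | true  | ofʸ k<i = contradiction (<-≤-trans k<i i≤j) k≮j
chainLine→0F (k ∷ c) i (suc j) i≤j | true | ofʸ k<1+j | false | ofⁿ k≮i =
  cong (0F ∷_) (chainLine→0F c i j (≤-pred (≤-trans (s≤s (≮⇒≥ k≮i)) k<1+j)))
chainLine→0F (k ∷ c) (suc i) (suc j) (s≤s i≤j) | true | ofʸ _ | true | ofʸ _ =
  cong (1F ∷_) (chainLine→0F c i j i≤j)

chainLine→1F : ∀ (c : Vec ℕ n) i j → i ≤ j → subst→ (chainLine c i j) 1F ≡ chainPoint c j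
chainLine→1F []      i j _ = refl
chainLine→1F (k ∷ c) i j i≤j with k <ᵇ j | <ᵇ-reflects-< k j | k <ᵇ i | <ᵇ-reflects-< k i
... | false | ofⁿ _ | _ | _ = cong (0F ∷_) (chainLine→1F c i j i≤j)
chainLine→1F (k ∷ c) i (suc j) i≤j | true | ofʸ k<1+j | false | ofⁿ k≮i =
  cong (1F ∷_) (chainLine→1F c i j (≤-pred (≤-trans (s≤s (≮⇒≥ k≮i)) k<1+j)))
chainLine→1F (k ∷ c) (suc i) (suc j) (s≤s i≤j) | true | ofʸ _ | true | ofʸ _ =
  cong (1F ∷_) (chainLine→1F c i j i≤j)

count-0F+1F : ∀ (y : Vec (Fin 2) n) → count 0F y + count 1F y ≡ n
count-0F+1F []       = refl
count-0F+1F (0F ∷ y) = cong suc (count-0F+1F y)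
count-0F+1F (1F ∷ y) = trans (+-suc _ _) (cong suc (count-0F+1F y))

count-1F+2F+0F : ∀ (y : Vec (Fin 3) n) → count 1F y + count 2F y + count 0F y ≡ n
count-1F+2F+0F []       = refl
count-1F+2F+0F (0F ∷ y) = trans (+-suc _ _) (cong suc (count-1F+2F+0F y))
count-1F+2F+0F (1F ∷ y) = cong suc (count-1F+2F+0F y)
count-1F+2F+0F (2F ∷ y) = trans (cong (_+ count 0F y) (+-suc (count 1F y) (count 2F y)))
                                (cong suc (count-1F+2F+0F y))

chainMultiplicity₂ : Vec (Fin 2) n → ℕ
chainMultiplicity₂ y = count 1F y ! * count 0F y !

chainMultiplicity₃ : Vec (Fin 3) n → ℕ
chainMultiplicity₃ y = count 1F y ! * count 2F y ! * count 0F y !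

-- Double counting of pairs (chain, point on it): a point y lies on chainMultiplicity₂ y chains,
-- always as the point with index count 1F y.
∑-chains-chainPoint : ∀ n (H : ℕ → Vec (Fin 2) n → ℕ) →
  ∑[ c ∈ chains n ] ∑[ a < suc n ] H a (chainPoint c a) ≡
  ∑[ y ∈ allVecs 2 n ] (H (count 1F y) y * chainMultiplicity₂ y)
∑-chains-chainPoint zero    H = cong (_+ 0) (trans (+-identityʳ _) (sym (*-identityʳ _)))
∑-chains-chainPoint (suc n) H = begin
  ∑[ c ∈ chains (suc n) ] ∑[ a < suc (suc n) ] H a (chainPoint c a)
    ≡⟨ ∑-chains-suc n _ ⟩
  ∑[ k < suc n ] ∑[ c ∈ chains n ] ∑[ a < suc (suc n) ] H a (chainPoint (k ∷ c) a)
    ≡⟨ ∑<-∑-comm (suc n) (chains n) (λ k c → ∑[ a < suc (suc n) ] H a (chainPoint (k ∷ c) a)) ⟩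
  ∑[ c ∈ chains n ] ∑[ k < suc n ] ∑[ a < suc (suc n) ] H a (chainPoint (k ∷ c) a)
    ≡⟨ ∑-cong (chains n) (λ c →
         trans (∑<-cong (suc n) (λ k _ → ∑<-cong (suc (suc n)) (λ a _ → chainPoint-∷ k c H a)))
               (∑<-∑<-split n (λ a → H a (0F ∷ chainPoint c a)) (λ a → H (suc a) (1F ∷ chainPoint c a)))) ⟩
  ∑[ c ∈ chains n ] (∑[ a < suc n ] H₀ a (chainPoint c a) + ∑[ a < suc n ] H₁ a (chainPoint c a))
    ≡⟨ ∑-+ (chains n) _ _ ⟩
  ∑[ c ∈ chains n ] ∑[ a < suc n ] H₀ a (chainPoint c a) + ∑[ c ∈ chains n ] ∑[ a < suc n ] H₁ a (chainPoint c a)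
    ≡⟨ cong₂ _+_ (∑-chains-chainPoint n H₀) (∑-chains-chainPoint n H₁) ⟩
  ∑[ y ∈ allVecs 2 n ] (H₀ (count 1F y) y * chainMultiplicity₂ y) +
  ∑[ y ∈ allVecs 2 n ] (H₁ (count 1F y) y * chainMultiplicity₂ y)
    ≡⟨ cong₂ _+_ (∑-cong (allVecs 2 n) head-0F) (trans (∑-cong (allVecs 2 n) head-1F) (sym (+-identityʳ _))) ⟩
  ∑[ i ∈ allFin 2 ] ∑[ y ∈ allVecs 2 n ] G (i ∷ y)
    ≡⟨ sym (∑-allVecs-suc 2 n G) ⟩
  ∑[ y ∈ allVecs 2 (suc n) ] G y ∎
  where
  open ≡-Reasoning
  H₀ H₁ : ℕ → Vec (Fin 2) n → ℕ
  H₀ a v = (suc n ∸ a) * H a (0F ∷ v)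
  H₁ a v = suc a * H (suc a) (1F ∷ v)
  G : Vec (Fin 2) (suc n) → ℕ
  G y = H (count 1F y) y * chainMultiplicity₂ y
  shift-right : ∀ s h a b → s * h * (a * b) ≡ h * (a * (s * b))
  shift-right = solve-∀
  shift-left : ∀ s h a b → s * h * (a * b) ≡ h * (s * a * b)
  shift-left = solve-∀
  head-0F : ∀ y → H₀ (count 1F y) y * chainMultiplicity₂ y ≡ G (0F ∷ y)
  head-0F y = trans (cong (λ z → z * H (count 1F y) (0F ∷ y) * chainMultiplicity₂ y) #0F)
                    (shift-right (suc (count 0F y)) (H (count 1F y) (0F ∷ y)) (count 1F y !) (count 0F y !))
    where
    #0F : suc n ∸ count 1F y ≡ suc (count 0F y)
    #0F = trans (cong (λ z → suc z ∸ count 1F y) (sym (count-0F+1F y)))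
            (trans (+-∸-assoc 1 (m≤n+m (count 1F y) (count 0F y))) (cong suc (m+n∸n≡m (count 0F y) (count 1F y))))
  head-1F : ∀ y → H₁ (count 1F y) y * chainMultiplicity₂ y ≡ G (1F ∷ y)
  head-1F y = shift-left (suc (count 1F y)) (H (suc (count 1F y)) (1F ∷ y)) (count 1F y !) (count 0F y !)

∑-chains-chainLine : ∀ n (H : ℕ → ℕ → Vec (Fin 3) n → ℕ) →
  ∑[ c ∈ chains n ] ∑[ i ≤ j ≤ n ] H i j (chainLine c i j) ≡
  ∑[ y ∈ allVecs 3 n ] (H (count 1F y) (count 1F y + count 2F y) y * chainMultiplicity₃ y)
∑-chains-chainLine zero    H = cong (_+ 0) (trans (+-identityʳ _) (trans (+-identityʳ _) (sym (*-identityʳ _))))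
∑-chains-chainLine (suc n) H = begin
  ∑[ c ∈ chains (suc n) ] ∑[ i ≤ j ≤ suc n ] H i j (chainLine c i j)
    ≡⟨ ∑-chains-suc n _ ⟩
  ∑[ k < suc n ] ∑[ c ∈ chains n ] ∑[ i ≤ j ≤ suc n ] H i j (chainLine (k ∷ c) i j)
    ≡⟨ ∑<-∑-comm (suc n) (chains n) (λ k c → ∑[ i ≤ j ≤ suc n ] H i j (chainLine (k ∷ c) i j)) ⟩
  ∑[ c ∈ chains n ] ∑[ k < suc n ] ∑[ i ≤ j ≤ suc n ] H i j (chainLine (k ∷ c) i j)
    ≡⟨ ∑-cong (chains n) (λ c →
         trans (∑<-cong (suc n) (λ k _ → ∑≤≤-cong (suc n) (λ i j _ _ → chainLine-∷ k c H i j)))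
               (∑<-∑≤≤-split n (λ i j → H i j (0F ∷ chainLine c i j)) (λ i j → H i (suc j) (2F ∷ chainLine c i j))
                               (λ i j → H (suc i) (suc j) (1F ∷ chainLine c i j)))) ⟩
  ∑[ c ∈ chains n ] (S₀ c + (S₂ c + S₁ c))
    ≡⟨ ∑-+ (chains n) S₀ _ ⟩
  ∑ (chains n) S₀ + ∑[ c ∈ chains n ] (S₂ c + S₁ c)
    ≡⟨ cong (∑ (chains n) S₀ +_) (trans (∑-+ (chains n) S₂ S₁) (+-comm (∑ (chains n) S₂) _)) ⟩
  ∑ (chains n) S₀ + (∑ (chains n) S₁ + ∑ (chains n) S₂)
    ≡⟨ cong₂ _+_ (trans (∑-chains-chainLine n H₀) (∑-cong (allVecs 3 n) head-0F))
         (cong₂ _+_ (trans (∑-chains-chainLine n H₁) (∑-cong (allVecs 3 n) head-1F))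
                    (trans (∑-chains-chainLine n H₂) (trans (∑-cong (allVecs 3 n) head-2F) (sym (+-identityʳ _))))) ⟩
  ∑[ i ∈ allFin 3 ] ∑[ y ∈ allVecs 3 n ] G (i ∷ y)
    ≡⟨ sym (∑-allVecs-suc 3 n G) ⟩
  ∑[ y ∈ allVecs 3 (suc n) ] G y ∎
  where
  open ≡-Reasoning
  H₀ H₁ H₂ : ℕ → ℕ → Vec (Fin 3) n → ℕ
  H₀ i j v = (suc n ∸ j) * H i j (0F ∷ v)
  H₁ i j v = suc i * H (suc i) (suc j) (1F ∷ v)
  H₂ i j v = (suc j ∸ i) * H i (suc j) (2F ∷ v)
  S₀ S₁ S₂ : Vec ℕ n → ℕ
  S₀ c = ∑[ i ≤ j ≤ n ] H₀ i j (chainLine c i j)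
  S₁ c = ∑[ i ≤ j ≤ n ] H₁ i j (chainLine c i j)
  S₂ c = ∑[ i ≤ j ≤ n ] H₂ i j (chainLine c i j)
  G : Vec (Fin 3) (suc n) → ℕ
  G y = H (count 1F y) (count 1F y + count 2F y) y * chainMultiplicity₃ y
  shift-right : ∀ s h a b c → s * h * (a * b * c) ≡ h * (a * b * (s * c))
  shift-right = solve-∀
  shift-middle : ∀ s h a b c → s * h * (a * b * c) ≡ h * (a * (s * b) * c)
  shift-middle = solve-∀
  shift-left : ∀ s h a b c → s * h * (a * b * c) ≡ h * (s * a * b * c)
  shift-left = solve-∀
  head-0F : ∀ y → H₀ (count 1F y) (count 1F y + count 2F y) y * chainMultiplicity₃ y ≡ G (0F ∷ y)
  head-0F y = trans (cong (λ z → z * H (count 1F y) (count 1F y + count 2F y) (0F ∷ y) * chainMultiplicity₃ y) #0F)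
                    (shift-right (suc (count 0F y)) (H (count 1F y) (count 1F y + count 2F y) (0F ∷ y))
                                 (count 1F y !) (count 2F y !) (count 0F y !))
    where
    #0F : suc n ∸ (count 1F y + count 2F y) ≡ suc (count 0F y)
    #0F = trans (cong (λ z → suc z ∸ (count 1F y + count 2F y)) (sym (count-1F+2F+0F y)))
            (trans (+-∸-assoc 1 (m≤m+n (count 1F y + count 2F y) (count 0F y)))
                   (cong suc (m+n∸m≡n (count 1F y + count 2F y) (count 0F y))))
  head-1F : ∀ y → H₁ (count 1F y) (count 1F y + count 2F y) y * chainMultiplicity₃ y ≡ G (1F ∷ y)
  head-1F y = shift-left (suc (count 1F y)) (H (suc (count 1F y)) (suc (count 1F y + count 2F y)) (1F ∷ y))
                         (count 1F y !) (count 2F y !) (count 0F y !)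
  head-2F : ∀ y → H₂ (count 1F y) (count 1F y + count 2F y) y * chainMultiplicity₃ y ≡ G (2F ∷ y)
  head-2F y = trans (cong₂ (λ z w → z * H (count 1F y) w (2F ∷ y) * chainMultiplicity₃ y)
                           #2F (sym (+-suc (count 1F y) (count 2F y))))
                    (shift-middle (suc (count 2F y)) (H (count 1F y) (count 1F y + suc (count 2F y)) (2F ∷ y))
                                  (count 1F y !) (count 2F y !) (count 0F y !))
    where
    #2F : suc (count 1F y + count 2F y) ∸ count 1F y ≡ suc (count 2F y)
    #2F = trans (cong (_∸ count 1F y) (sym (+-suc (count 1F y) (count 2F y)))) (m+n∸m≡n (count 1F y) (suc (count 2F y)))

sameSlice⇒≡ : ∀ {k} (x y : Vec (Fin k) n) → sameSlice x y ≡ true → slice x ≡ slice y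
sameSlice⇒≡ x y e = toWitness {a? = ≡-dec _≟_ (slice x) (slice y)} (subst T (sym e) tt)

≡⇒sameSlice : ∀ {k} (x y : Vec (Fin k) n) → slice x ≡ slice y → sameSlice x y ≡ true
≡⇒sameSlice x y e = trans (isYes≗does d) (dec-true d e)
  where d = ≡-dec _≟_ (slice x) (slice y)

∑-sameSlice : ∀ {k} (x : Vec (Fin k) n) (W : Vec ℕ k → ℕ) →
  ∑[ y ∈ allVecs k n ] (𝟙 (sameSlice x y) * W (slice y)) ≡ sliceSize x * W (slice x)
∑-sameSlice {n} {k} x W = begin
  ∑[ y ∈ allVecs k n ] (𝟙 (sameSlice x y) * W (slice y)) ≡⟨ ∑-cong (allVecs k n) on-slice ⟩
  ∑[ y ∈ allVecs k n ] (𝟙 (sameSlice x y) * W (slice x)) ≡⟨ ∑-*ʳ (allVecs k n) (W (slice x)) _ ⟩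
  ∑[ y ∈ allVecs k n ] 𝟙 (sameSlice x y) * W (slice x)
    ≡⟨ cong (_* W (slice x)) (sym (length-filter (sameSlice x) (allVecs k n))) ⟩
  sliceSize x * W (slice x)                               ∎
  where
  open ≡-Reasoning
  on-slice : ∀ y → 𝟙 (sameSlice x y) * W (slice y) ≡ 𝟙 (sameSlice x y) * W (slice x)
  on-slice y with sameSlice x y in e
  ... | true  = cong (λ s → 1 * W s) (sym (sameSlice⇒≡ x y e))
  ... | false = refl

slice₂-≡ : ∀ (x y : Vec (Fin 2) n) → count 1F x ≡ count 1F y → slice x ≡ slice y
slice₂-≡ x y #1F = cong₂ (λ a b → a ∷ b ∷ []) #0F #1F
  where
  #0F : count 0F x ≡ count 0F y
  #0F = trans (sym (m+n∸n≡m (count 0F x) (count 1F x)))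
          (trans (cong₂ _∸_ (trans (count-0F+1F x) (sym (count-0F+1F y))) #1F) (m+n∸n≡m (count 0F y) (count 1F y)))

slice₃-≡ : ∀ (x y : Vec (Fin 3) n) → count 1F x ≡ count 1F y → count 2F x ≡ count 2F y → slice x ≡ slice y
slice₃-≡ x y #1F #2F = cong₂ _∷_ #0F (cong₂ (λ a b → a ∷ b ∷ []) #1F #2F)
  where
  #0F : count 0F x ≡ count 0F y
  #0F = trans (sym (m+n∸m≡n (count 1F x + count 2F x) (count 0F x)))
          (trans (cong₂ _∸_ (trans (count-1F+2F+0F x) (sym (count-1F+2F+0F y))) (cong₂ _+_ #1F #2F))
                 (m+n∸m≡n (count 1F y + count 2F y) (count 0F y)))

sliceSize₂ : ∀ n (x : Vec (Fin 2) n) → sliceSize x * chainMultiplicity₂ x ≡ n !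
sliceSize₂ n x = sym (begin
  n !                                                     ≡⟨ sym (∑-chains-1 n) ⟩
  ∑[ _ ∈ chains n ] 1
    ≡⟨ ∑-chains-cong n (λ c c-ok → sym (one-point-in-slice c c-ok)) ⟩
  ∑[ c ∈ chains n ] ∑[ a < suc n ] H a (chainPoint c a)   ≡⟨ ∑-chains-chainPoint n H ⟩
  ∑[ y ∈ allVecs 2 n ] (H (count 1F y) y * chainMultiplicity₂ y)
    ≡⟨ ∑-cong (allVecs 2 n) (λ y →
         reorder (𝟙 (count 1F y ≡ᵇ t)) (𝟙 (sameSlice x y)) (chainMultiplicity₂ y)) ⟩
  ∑[ y ∈ allVecs 2 n ] (𝟙 (sameSlice x y) * W (slice y)) ≡⟨ ∑-sameSlice x W ⟩
  sliceSize x * W (slice x)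
    ≡⟨ cong (λ z → sliceSize x * (z * chainMultiplicity₂ x)) (𝟙-≡ᵇ-refl t) ⟩
  sliceSize x * (1 * chainMultiplicity₂ x)                ≡⟨ cong (sliceSize x *_) (*-identityˡ _) ⟩
  sliceSize x * chainMultiplicity₂ x                      ∎)
  where
  open ≡-Reasoning
  t = count 1F x
  H : ℕ → Vec (Fin 2) n → ℕ
  H a v = 𝟙 (a ≡ᵇ t) * 𝟙 (sameSlice x v)
  W : Vec ℕ 2 → ℕ
  W s = 𝟙 (lookup s 1F ≡ᵇ t) * (lookup s 1F ! * lookup s 0F !)
  reorder : ∀ a b m → a * b * m ≡ b * (a * m)
  reorder = solve-∀
  t≤n : t ≤ n
  t≤n = subst (t ≤_) (count-0F+1F x) (m≤n+m t (count 0F x))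
  one-point-in-slice : ∀ c → IsChainCode c → ∑[ a < suc n ] H a (chainPoint c a) ≡ 1
  one-point-in-slice c c-ok = trans (∑<-pick (suc n) t (λ a → 𝟙 (sameSlice x (chainPoint c a))) (s≤s t≤n))
    (cong 𝟙 (≡⇒sameSlice x (chainPoint c t) (slice₂-≡ x (chainPoint c t) (sym (count-chainPoint c t c-ok t≤n)))))

sliceSize₃ : ∀ n (x : Vec (Fin 3) n) → sliceSize x * chainMultiplicity₃ x ≡ n !
sliceSize₃ n x = sym (begin
  n !                                                         ≡⟨ sym (∑-chains-1 n) ⟩
  ∑[ _ ∈ chains n ] 1
    ≡⟨ ∑-chains-cong n (λ c c-ok → sym (one-line-in-slice c c-ok)) ⟩
  ∑[ c ∈ chains n ] ∑[ i ≤ j ≤ n ] H i j (chainLine c i j)    ≡⟨ ∑-chains-chainLine n H ⟩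
  ∑[ y ∈ allVecs 3 n ] (H (count 1F y) (count 1F y + count 2F y) y * chainMultiplicity₃ y)
    ≡⟨ ∑-cong (allVecs 3 n) (λ y → reorder (𝟙 (count 1F y + count 2F y ≡ᵇ t)) (𝟙 (count 1F y ≡ᵇ s))
                                           (𝟙 (sameSlice x y)) (chainMultiplicity₃ y)) ⟩
  ∑[ y ∈ allVecs 3 n ] (𝟙 (sameSlice x y) * W (slice y))     ≡⟨ ∑-sameSlice x W ⟩
  sliceSize x * W (slice x)
    ≡⟨ cong₂ (λ u v → sliceSize x * (u * (v * chainMultiplicity₃ x))) (𝟙-≡ᵇ-refl t) (𝟙-≡ᵇ-refl s) ⟩
  sliceSize x * (1 * (1 * chainMultiplicity₃ x))
    ≡⟨ cong (sliceSize x *_) (trans (*-identityˡ _) (*-identityˡ _)) ⟩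
  sliceSize x * chainMultiplicity₃ x                          ∎)
  where
  open ≡-Reasoning
  s = count 1F x
  t = count 1F x + count 2F x
  H : ℕ → ℕ → Vec (Fin 3) n → ℕ
  H i j v = 𝟙 (j ≡ᵇ t) * (𝟙 (i ≡ᵇ s) * 𝟙 (sameSlice x v))
  W : Vec ℕ 3 → ℕ
  W v = 𝟙 (lookup v 1F + lookup v 2F ≡ᵇ t) * (𝟙 (lookup v 1F ≡ᵇ s) * (lookup v 1F ! * lookup v 2F ! * lookup v 0F !))
  reorder : ∀ a b c m → a * (b * c) * m ≡ c * (a * (b * m))
  reorder = solve-∀
  s≤t : s ≤ t
  s≤t = m≤m+n s (count 2F x)
  t≤n : t ≤ n
  t≤n = subst (t ≤_) (count-1F+2F+0F x) (m≤m+n t (count 0F x))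
  one-line-in-slice : ∀ c → IsChainCode c → ∑[ i ≤ j ≤ n ] H i j (chainLine c i j) ≡ 1
  one-line-in-slice c c-ok = trans (∑≤≤-pick n s t (λ i j → 𝟙 (sameSlice x (chainLine c i j))) s≤t t≤n)
    (cong 𝟙 (≡⇒sameSlice x (chainLine c s t)
      (slice₃-≡ x (chainLine c s t) (sym #1F) (sym (trans #2F (m+n∸m≡n s (count 2F x)))))))
    where
    #1F = proj₁ (count-chainLine c s t c-ok s≤t t≤n)
    #2F = proj₂ (count-chainLine c s t c-ok s≤t t≤n)

incidences₂ : (Vec (Fin 2) n → Bool) → ℕ
incidences₂ {n} A = ∑[ y ∈ allVecs 2 n ] (𝟙 (A y) * chainMultiplicity₂ y)

incidences₃ : (Vec (Fin 3) n → Bool) → ℕ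
incidences₃ {n} L = ∑[ y ∈ allVecs 3 n ] (𝟙 (L y) * chainMultiplicity₃ y)

incidences₂-chains : ∀ n (A : Vec (Fin 2) n → Bool) →
  incidences₂ A ≡ ∑[ c ∈ chains n ] ∑[ a < suc n ] 𝟙 (A (chainPoint c a))
incidences₂-chains n A = sym (∑-chains-chainPoint n (λ _ v → 𝟙 (A v)))

incidences₃-lines : ∀ n (A : Vec (Fin 2) n → Bool) →
  incidences₃ (lines A) ≡ ∑[ c ∈ chains n ] ∑[ i ≤ j ≤ n ] (𝟙 (A (chainPoint c i)) * 𝟙 (A (chainPoint c j)))
incidences₃-lines n A = trans (sym (∑-chains-chainLine n (λ _ _ v → 𝟙 (lines A v))))
  (∑-cong (chains n) (λ c → ∑≤≤-cong n (λ i j i≤j _ → line-in-A c i j i≤j)))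
  where
  line-in-A : ∀ c i j → i ≤ j → 𝟙 (lines A (chainLine c i j)) ≡ 𝟙 (A (chainPoint c i)) * 𝟙 (A (chainPoint c j))
  line-in-A c i j i≤j rewrite chainLine→0F c i j i≤j | chainLine→1F c i j i≤j =
    𝟙-∧ (A (chainPoint c i)) (A (chainPoint c j))

-- Cauchy–Schwarz over the n! chains, then (∑ₐ fₐ)² ≤ 2 ∑_{i ≤ j} fᵢ fⱼ on each chain.
incidences₂²≤ : ∀ n (A : Vec (Fin 2) n → Bool) →
  incidences₂ A * incidences₂ A ≤ n ! * (2 * incidences₃ (lines A))
incidences₂²≤ n A rewrite incidences₂-chains n A | incidences₃-lines n A = begin
  ∑ (chains n) Y * ∑ (chains n) Y                ≤⟨ cauchy-schwarz (chains n) Y ⟩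
  length (chains n) * ∑[ c ∈ chains n ] (Y c * Y c)
    ≤⟨ *-mono-≤ (≤-reflexive (length-chains n)) (∑-mono-≤ (chains n) (λ c → square-≤-2*∑≤≤ n (f c))) ⟩
  n ! * ∑[ c ∈ chains n ] (2 * P c)              ≡⟨ cong (n ! *_) (∑-*ˡ (chains n) 2 P) ⟩
  n ! * (2 * ∑ (chains n) P)                     ∎
  where
  open ≤-Reasoning
  f : Vec ℕ n → ℕ → ℕ
  f c a = 𝟙 (A (chainPoint c a))
  Y P : Vec ℕ n → ℕ
  Y c = ∑< (suc n) (f c)
  P c = ∑[ i ≤ j ≤ n ] (f c i * f c j)

length-tuples-suc : ∀ k m → length (tuples (suc k) m) ≡ ∑[ a < suc m ] length (tuples k (m ∸ a))
length-tuples-suc k m = trans (length-concatMap (λ a → map (a ∷_) (tuples k (m ∸ a))) (upTo (suc m)))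
  (trans (∑-cong (upTo (suc m)) (λ a → List.length-map (a ∷_) (tuples k (m ∸ a)))) (∑-upTo (suc m) _))

length-tuples₁ : ∀ m → length (tuples 1 m) ≡ 1
length-tuples₁ m = trans (length-tuples-suc 0 m) (go m)
  where
  go : ∀ m → ∑[ a < suc m ] length (tuples 0 (m ∸ a)) ≡ 1
  go zero    = refl
  go (suc m) = go m

length-tuples₂ : ∀ n → length (tuples 2 n) ≡ n + 1
length-tuples₂ n = trans (length-tuples-suc 1 n)
  (trans (∑<-cong (suc n) (λ a _ → length-tuples₁ (n ∸ a)))
  (trans (∑<-const (suc n) 1) (trans (*-identityʳ (suc n)) (+-comm 1 n))))

length-tuples₃ : ∀ n → 2 * length (tuples 3 n) ≡ (n + 1) * (n + 2)
length-tuples₃ n = begin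
  2 * length (tuples 3 n)
    ≡⟨ cong (2 *_) (length-tuples-suc 2 n) ⟩
  2 * ∑[ a < suc n ] length (tuples 2 (n ∸ a))
    ≡⟨ cong (2 *_) (∑<-cong (suc n) (λ a _ → trans (length-tuples₂ (n ∸ a)) (+-comm (n ∸ a) 1))) ⟩
  2 * ∑[ a < suc n ] suc (n ∸ a)
    ≡⟨ triangle n ⟩
  suc n * suc (suc n)
    ≡⟨ cong₂ _*_ (+-comm 1 n) (+-comm 2 n) ⟩
  (n + 1) * (n + 2) ∎
  where
  open ≡-Reasoning
  triangle : ∀ n → 2 * ∑[ a < suc n ] suc (n ∸ a) ≡ suc n * suc (suc n)
  triangle zero    = refl
  triangle (suc n) = trans (*-distribˡ-+ 2 (suc (suc n)) _) (trans (cong (2 * suc (suc n) +_) (triangle n)) (step n))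
    where
    step : ∀ n → 2 * suc (suc n) + suc n * suc (suc n) ≡ suc (suc n) * suc (suc (suc n))
    step = solve-∀

-- a / d; mkℚᵘ stores the denominator minus one, so d ≥ 1 is assumed throughout.
ratio : ℕ → ℕ → ℚᵘ
ratio a d = mkℚᵘ (ℤ.+ a) (pred d)

ratio-≃ : ∀ {a b d e} → 1 ≤ d → 1 ≤ e → a * e ≡ b * d → ratio a d ℚᵘ.≃ ratio b e
ratio-≃ {a} {b} {d} {e} (s≤s _) (s≤s _) eq = *≡* (trans (sym (ℤ.pos-* a e)) (trans (cong ℤ.+_ eq) (ℤ.pos-* b d)))

ratio-≤ : ∀ {a b d e} → 1 ≤ d → 1 ≤ e → a * e ≤ b * d → ratio a d ℚᵘ.≤ ratio b e
ratio-≤ {a} {b} {d} {e} (s≤s _) (s≤s _) le = *≤* (subst₂ ℤ._≤_ (ℤ.pos-* a e) (ℤ.pos-* b d) (+≤+ le))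

ratio-* : ∀ {a b d e} → 1 ≤ d → 1 ≤ e → ratio a d ℚᵘ.* ratio b e ℚᵘ.≃ ratio (a * b) (d * e)
ratio-* {a} {b} {d} {e} (s≤s _) (s≤s _) =
  ℚᵘ.≃-reflexive (cong (λ z → mkℚᵘ z (pred (d * e))) (sym (ℤ.pos-* a b)))

ratio-+ : ∀ {a b d} → 1 ≤ d → ratio a d ℚᵘ.+ ratio b d ℚᵘ.≃ ratio (a + b) d
ratio-+ {a} {b} {d} (s≤s _) = *≡* (begin
  (ℤ.+ a ℤ.* ℤ.+ d ℤ.+ ℤ.+ b ℤ.* ℤ.+ d) ℤ.* ℤ.+ d
    ≡⟨ cong (ℤ._* ℤ.+ d) (cong₂ ℤ._+_ (sym (ℤ.pos-* a d)) (sym (ℤ.pos-* b d))) ⟩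
  (ℤ.+ (a * d) ℤ.+ ℤ.+ (b * d)) ℤ.* ℤ.+ d
    ≡⟨ cong (ℤ._* ℤ.+ d) (sym (ℤ.pos-+ (a * d) (b * d))) ⟩
  ℤ.+ (a * d + b * d) ℤ.* ℤ.+ d     ≡⟨ sym (ℤ.pos-* (a * d + b * d) d) ⟩
  ℤ.+ ((a * d + b * d) * d)         ≡⟨ cong ℤ.+_ (regroup a b d) ⟩
  ℤ.+ ((a + b) * (d * d))           ≡⟨ ℤ.pos-* (a + b) (d * d) ⟩
  ℤ.+ (a + b) ℤ.* ℤ.+ (d * d)       ∎)
  where
  open ≡-Reasoning
  regroup : ∀ a b d → (a * d + b * d) * d ≡ (a + b) * (d * d)
  regroup = solve-∀

toℚᵘ-frac : ∀ a {d} → 1 ≤ d → ℚ.toℚᵘ (frac a d) ℚᵘ.≃ ratio a d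
toℚᵘ-frac a {suc d} _ = ℚ.toℚᵘ-fromℚᵘ (mkℚᵘ (ℤ.+ a) d)

toℚᵘ-∑-esWeight : ∀ k n (S : Vec (Fin k) n → Bool) (f : Vec (Fin k) n → ℕ) {D} → 1 ≤ D →
  (∀ x → ℚ.toℚᵘ (esWeight k n x) ℚᵘ.≃ ratio (f x) D) → ∀ xs →
  ℚ.toℚᵘ (sumℚ (map (esWeight k n) (filter (λ x → T? (S x)) xs))) ℚᵘ.≃ ratio (∑[ x ∈ xs ] (𝟙 (S x) * f x)) D
toℚᵘ-∑-esWeight k n S f (s≤s _) weight [] = *≡* refl
toℚᵘ-∑-esWeight k n S f {D} 1≤D weight (x ∷ xs) with S x
... | false = toℚᵘ-∑-esWeight k n S f 1≤D weight xs
... | true  = begin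
  ℚ.toℚᵘ (esWeight k n x ℚ.+ rest)
    ≈⟨ ℚ.toℚᵘ-homo-+ (esWeight k n x) rest ⟩
  ℚ.toℚᵘ (esWeight k n x) ℚᵘ.+ ℚ.toℚᵘ rest
    ≈⟨ ℚᵘ.+-cong (weight x) (toℚᵘ-∑-esWeight k n S f 1≤D weight xs) ⟩
  ratio (f x) D ℚᵘ.+ ratio ∑rest D
    ≈⟨ ratio-+ {f x} 1≤D ⟩
  ratio (f x + ∑rest) D
    ≈⟨ ℚᵘ.≃-reflexive (cong (λ z → ratio (z + ∑rest) D) (sym (+-identityʳ (f x)))) ⟩
  ratio (1 * f x + ∑rest) D ∎
  where
  open ℚᵘ.≃-Reasoning
  rest = sumℚ (map (esWeight k n) (filter (λ x → T? (S x)) xs))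
  ∑rest = ∑[ x ∈ xs ] (𝟙 (S x) * f x)

1≤-factor : ∀ a {b c} → a * b ≡ c → 1 ≤ c → 1 ≤ a
1≤-factor zero    refl ()
1≤-factor (suc a) _    _ = s≤s z≤n

esWeight-≃ : ∀ k n (x : Vec (Fin k) n) {m T} → length (tuples k n) ≡ T → 1 ≤ T → sliceSize x * m ≡ n ! →
  ℚ.toℚᵘ (esWeight k n x) ℚᵘ.≃ ratio m (T * n !)
esWeight-≃ k n x {m} {T} refl 1≤T size = ℚᵘ.≃-trans (toℚᵘ-frac 1 1≤T*size)
  (ratio-≃ 1≤T*size (*-mono-≤ 1≤T (1≤n! n)) (trans (*-identityˡ _) (sym cross)))
  where
  1≤T*size : 1 ≤ T * sliceSize x
  1≤T*size = *-mono-≤ 1≤T (1≤-factor (sliceSize x) size (1≤n! n))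
  cross : m * (T * sliceSize x) ≡ T * n !
  cross = trans (regroup m T (sliceSize x)) (cong (T *_) size)
    where
    regroup : ∀ m T s → m * (T * s) ≡ T * (s * m)
    regroup = solve-∀

1≤[n+1]*n! : ∀ n → 1 ≤ (n + 1) * n !
1≤[n+1]*n! n = *-mono-≤ (m≤n+m 1 n) (1≤n! n)

1≤T₃ : ∀ n → 1 ≤ length (tuples 3 n)
1≤T₃ n = 1≤-factor (length (tuples 3 n)) {2} (trans (*-comm (length (tuples 3 n)) 2) (length-tuples₃ n))
  (*-mono-≤ (m≤n+m 1 n) (≤-trans (s≤s z≤n) (m≤n+m 2 n)))

1≤T₃*n! : ∀ n → 1 ≤ length (tuples 3 n) * n !
1≤T₃*n! n = *-mono-≤ (1≤T₃ n) (1≤n! n)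

esMeasure₂-≃ : ∀ n (A : Vec (Fin 2) n → Bool) →
  ℚ.toℚᵘ (esMeasure 2 n A) ℚᵘ.≃ ratio (incidences₂ A) ((n + 1) * n !)
esMeasure₂-≃ n A = toℚᵘ-∑-esWeight 2 n A chainMultiplicity₂ (1≤[n+1]*n! n)
  (λ x → esWeight-≃ 2 n x (length-tuples₂ n) (m≤n+m 1 n) (sliceSize₂ n x)) (allVecs 2 n)

esMeasure₃-≃ : ∀ n (L : Vec (Fin 3) n → Bool) →
  ℚ.toℚᵘ (esMeasure 3 n L) ℚᵘ.≃ ratio (incidences₃ L) (length (tuples 3 n) * n !)
esMeasure₃-≃ n L = toℚᵘ-∑-esWeight 3 n L chainMultiplicity₃ (1≤T₃*n! n)
  (λ x → esWeight-≃ 3 n x refl (1≤T₃ n) (sliceSize₃ n x)) (allVecs 3 n)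

cross-multiplied : ∀ S₂ S₃ N T m p → S₂ * S₂ ≤ N * (2 * S₃) → 2 * T ≡ m * p →
  S₂ * S₂ * m * (T * N) ≤ S₃ * (m * N * (m * N) * p)
cross-multiplied S₂ S₃ N T m p S₂²≤ 2T≡mp = *-cancelˡ-≤ 2 (begin
  2 * (S₂ * S₂ * m * (T * N))     ≡⟨ regroupˡ S₂ T N m ⟩
  S₂ * S₂ * (m * (2 * T) * N)     ≡⟨ cong (λ z → S₂ * S₂ * (m * z * N)) 2T≡mp ⟩
  S₂ * S₂ * (m * (m * p) * N)     ≤⟨ *-monoˡ-≤ (m * (m * p) * N) S₂²≤ ⟩
  N * (2 * S₃) * (m * (m * p) * N) ≡⟨ regroupʳ S₃ N m p ⟩
  2 * (S₃ * (m * N * (m * N) * p)) ∎)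
  where
  open ≤-Reasoning
  regroupˡ : ∀ S T N m → 2 * (S * S * m * (T * N)) ≡ S * S * (m * (2 * T) * N)
  regroupˡ = solve-∀
  regroupʳ : ∀ S N m p → N * (2 * S) * (m * (m * p) * N) ≡ 2 * (S * (m * N * (m * N) * p))
  regroupʳ = solve-∀

toℚᵘ-square-*-frac : ∀ (δ : ℚ.ℚ) {S D} a {e} → 1 ≤ D → 1 ≤ e → ℚ.toℚᵘ δ ℚᵘ.≃ ratio S D →
  ℚ.toℚᵘ (δ ℚ.* δ ℚ.* frac a e) ℚᵘ.≃ ratio (S * S * a) (D * D * e)
toℚᵘ-square-*-frac δ {S} {D} a {e} 1≤D 1≤e δ≃ = begin
  ℚ.toℚᵘ (δ ℚ.* δ ℚ.* frac a e)            ≈⟨ ℚ.toℚᵘ-homo-* (δ ℚ.* δ) (frac a e) ⟩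
  ℚ.toℚᵘ (δ ℚ.* δ) ℚᵘ.* ℚ.toℚᵘ (frac a e)  ≈⟨ ℚᵘ.*-cong (ℚ.toℚᵘ-homo-* δ δ) (toℚᵘ-frac a 1≤e) ⟩
  ℚ.toℚᵘ δ ℚᵘ.* ℚ.toℚᵘ δ ℚᵘ.* ratio a e    ≈⟨ ℚᵘ.*-cong (ℚᵘ.*-cong δ≃ δ≃) ℚᵘ.≃-refl ⟩
  ratio S D ℚᵘ.* ratio S D ℚᵘ.* ratio a e  ≈⟨ ℚᵘ.*-cong (ratio-* {S} {S} 1≤D 1≤D) ℚᵘ.≃-refl ⟩
  ratio (S * S) (D * D) ℚᵘ.* ratio a e     ≈⟨ ratio-* {S * S} (*-mono-≤ 1≤D 1≤D) 1≤e ⟩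
  ratio (S * S * a) (D * D * e)            ∎
  where open ℚᵘ.≃-Reasoning

theorem3p1 : (n : ℕ) → n ≥ 1 → (A : Vec (Fin 2) n → Bool) →
    esMeasure 2 n A ℚ.* esMeasure 2 n A ℚ.* frac (n + 1) (n + 2) ℚ.≤ esMeasure 3 n (lines A)
theorem3p1 n _ A = ℚ.toℚᵘ-cancel-≤ (begin
  ℚ.toℚᵘ (δ ℚ.* δ ℚ.* frac (n + 1) (n + 2))
    ≃⟨ toℚᵘ-square-*-frac δ (n + 1) 1≤D₂ 1≤n+2 (esMeasure₂-≃ n A) ⟩
  ratio (S₂ * S₂ * (n + 1)) (D₂ * D₂ * (n + 2))
    ≤⟨ ratio-≤ (*-mono-≤ (*-mono-≤ 1≤D₂ 1≤D₂) 1≤n+2) (1≤T₃*n! n)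
         (cross-multiplied S₂ S₃ (n !) T₃ (n + 1) (n + 2) (incidences₂²≤ n A) (length-tuples₃ n)) ⟩
  ratio S₃ (T₃ * n !)
    ≃⟨ esMeasure₃-≃ n (lines A) ⟨
  ℚ.toℚᵘ (esMeasure 3 n (lines A)) ∎)
  where
  open ℚᵘ.≤-Reasoning
  δ = esMeasure 2 n A
  S₂ = incidences₂ A
  S₃ = incidences₃ (lines A)
  T₃ = length (tuples 3 n)
  D₂ = (n + 1) * n !
  1≤D₂ = 1≤[n+1]*n! n
  1≤n+2 = ≤-trans (s≤s z≤n) (m≤n+m 2 n)
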